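{- Let $R$ be a commutative ring with unity, let $G$ be a graph and $G'$ a subgraph of $G$. If $(G,\alpha)$ satisfies the Universal Difference Property for every edge-labeling $\alpha$ of $G$ over $R$, then $(G',\beta)$ satisfies the Universal Difference Property for every edge-labeling $\beta$ of $G'$ over $R$.
   Context: An edge-labeling assigns to each edge an ideal of $R$. A spline on $(G,\alpha)$ is a function $\rho:V(G)\to R$ with $\rho(u)-\rho(v)\in\alpha(uv)$ for every edge $uv$. A path has no repeated vertices; for a path $P$, $\alpha(P)$ is the sum of the labels of its edges. $(G,\alpha)$ satisfies the Universal Difference Property if for every pair of vertices $u,w$ and every $x\in\bigcap_P\alpha(P)$ (over all paths $P$ from $u$ to $w$ in $G$) there is a spline $\rho$ with $\rho(u)-\rho(w)=x$. -}

module Defs where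

open import Level using (Level; _⊔_; suc)
open import Algebra.Bundles using (CommutativeRing)
open import Data.Nat using (ℕ)
open import Data.Fin using (Fin)
open import Data.Product using (Σ; ∃; ∃-syntax; _×_; _,_; proj₁; proj₂)
open import Data.Sum using (_⊎_)
open import Data.List using (List; []; _∷_)
open import Data.List.Relation.Unary.Unique.Propositional using (Unique)
open import Relation.Binary.PropositionalEquality using (_≡_; _≢_)
open import Function.Definitions using (Injective)

module _ {c ℓ} (R : CommutativeRing c ℓ) where
  open CommutativeRing R

  record Ideal (ℓi : Level) : Set (c ⊔ ℓ ⊔ suc ℓi) where
    field
      _∋_      : Carrier → Set ℓi
      ∋-resp-≈ : ∀ {x y} → x ≈ y → _∋_ x → _∋_ y
      ∋-0#     : _∋_ 0#
      ∋-+      : ∀ {x y} → _∋_ x → _∋_ y → _∋_ (x + y)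
      ∋-*      : ∀ r {x} → _∋_ x → _∋_ (r * x)

record Graph : Set where
  field
    nV   : ℕ
    nE   : ℕ
    ends : Fin nE → Fin nV × Fin nV

  Joins : Fin nE → Fin nV → Fin nV → Set
  Joins e u v = (ends e ≡ (u , v)) ⊎ (ends e ≡ (v , u))

record SimpleGraph : Set where
  field
    graph  : Graph
  open Graph graph public
  field
    loopless : ∀ e → proj₁ (ends e) ≢ proj₂ (ends e)
    noMulti  : ∀ e f → Joins e (proj₁ (ends f)) (proj₂ (ends f)) → e ≡ f

record Subgraph (G' G : SimpleGraph) : Set where
  private
    module G' = SimpleGraph G'
    module G  = SimpleGraph G
  field
    vmap     : Fin G'.nV → Fin G.nV
    emap     : Fin G'.nE → Fin G.nE
    vmap-inj : Injective _≡_ _≡_ vmap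
    emap-inj : Injective _≡_ _≡_ emap
    ends-compat : ∀ e → G.Joins (emap e) (vmap (proj₁ (G'.ends e))) (vmap (proj₂ (G'.ends e)))

module _ (G : SimpleGraph) where
  open SimpleGraph G

  data Walk : Fin nV → Fin nV → Set where
    []  : ∀ {u} → Walk u u
    _∷_ : ∀ {u v w} → (Σ (Fin nE) λ e → Joins e u v) → Walk v w → Walk u w

  vertices : ∀ {u w} → Walk u w → List (Fin nV)
  vertices {u} []      = u ∷ []
  vertices {u} (_ ∷ p) = u ∷ vertices p

  IsPath : ∀ {u w} → Walk u w → Set
  IsPath p = Unique (vertices p)

  module _ {c ℓ} (R : CommutativeRing c ℓ) where
    open CommutativeRing R

    EdgeLabeling : (ℓi : Level) → Set (c ⊔ ℓ ⊔ suc ℓi)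
    EdgeLabeling ℓi = Fin nE → Ideal R ℓi

    -- membership in α(P) = sum of the ideals labeling the edges of P
    -- (the empty sum is the zero ideal)
    InPathIdeal : ∀ {ℓi : Level} → EdgeLabeling ℓi → ∀ {u w} → Walk u w → Carrier → Set (c ⊔ ℓ ⊔ ℓi)
    InPathIdeal {ℓi} α [] x = Level.Lift (c ⊔ ℓi) (x ≈ 0#)
    InPathIdeal α ((e , _) ∷ p) x =
      ∃[ a ] ∃[ b ] (Ideal._∋_ (α e) a × InPathIdeal α p b × x ≈ a + b)

    IsSpline : ∀ {ℓi} → EdgeLabeling ℓi → (Fin nV → Carrier) → Set ℓi
    IsSpline α ρ = ∀ e → Ideal._∋_ (α e) (ρ (proj₁ (ends e)) - ρ (proj₂ (ends e)))

    UniversalDifferenceProperty : ∀ {ℓi} → EdgeLabeling ℓi → Set (c ⊔ ℓ ⊔ ℓi)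
    UniversalDifferenceProperty α =
      ∀ u w (x : Carrier) →
        (∀ (P : Walk u w) → IsPath P → InPathIdeal α P x) →
        ∃[ ρ ] (IsSpline α ρ × (ρ u - ρ w) ≈ x)

{-# OPTIONS --safe #-}
-- Extend β to a labeling α of G by giving every edge outside G' the whole
-- ring. A path of G between two vertices of G' either uses such an edge, and
-- then α of it is the whole ring, or it is the image of a path P of G', and
-- then α of it contains β(P). Hence x lies in α of every such path, the UDP
-- for α gives a spline on G with difference x, and its restriction to G' is a
-- spline for β with the same difference.
module Submission where

open import Defs
open import Level using (Level; _⊔_; lift)
open import Algebra.Bundles using (CommutativeRing)
open import Data.Fin using (Fin)
open import Data.Fin.Properties using (any?) renaming (_≟_ to _≟ᶠ_)
open import Data.Product using (Σ-syntax; _×_; _,_; proj₁; proj₂; swap)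
open import Data.Product.Properties using (,-injectiveˡ; ,-injectiveʳ)
open import Data.Sum using (_⊎_; inj₁; inj₂)
open import Data.List using (_∷_; map)
open import Data.List.Relation.Unary.Unique.Propositional using (Unique)
open import Data.List.Relation.Unary.Unique.Propositional.Properties using (map⁻)
open import Function using (_∘_)
open import Relation.Nullary using (yes; no; contradiction)
open import Relation.Binary.PropositionalEquality using (_≡_; refl; sym; trans; cong; subst)
import Algebra.Properties.Ring as RingProperties
import Algebra.Properties.AbelianGroup as AbelianGroupProperties

open Ideal using (_∋_)

module _ {c ℓ ℓi} {R : CommutativeRing c ℓ} (I : Ideal R ℓi) where
  open CommutativeRing R hiding (refl; sym) renaming (trans to ≈-trans)

  ∋-diff-swap : ∀ {a b} → I ∋ (a - b) → I ∋ (b - a)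
  ∋-diff-swap {a} {b} a-b∈I = Ideal.∋-resp-≈ I -1*[a-b]≈b-a (Ideal.∋-* I (- 1#) a-b∈I)
    where
    -1*[a-b]≈b-a : - 1# * (a - b) ≈ b - a
    -1*[a-b]≈b-a = ≈-trans (RingProperties.-1*x≈-x ring (a - b))
                         (AbelianGroupProperties.⁻¹-anti-homo‿- +-abelianGroup a b)

module _ (G : Graph) where
  open Graph G

  Joins-unique : ∀ {e u v x y} → Joins e u v → Joins e x y →
                 (u , v) ≡ (x , y) ⊎ (u , v) ≡ (y , x)
  Joins-unique (inj₁ e=uv) (inj₁ e=xy) = inj₁ (trans (sym e=uv) e=xy)
  Joins-unique (inj₁ e=uv) (inj₂ e=yx) = inj₂ (trans (sym e=uv) e=yx)
  Joins-unique (inj₂ e=vu) (inj₁ e=xy) = inj₂ (cong swap (trans (sym e=vu) e=xy))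
  Joins-unique (inj₂ e=vu) (inj₂ e=yx) = inj₁ (cong swap (trans (sym e=vu) e=yx))

module _ {c ℓ ℓi} {R : CommutativeRing c ℓ} (G : SimpleGraph) (α : EdgeLabeling G R ℓi) where
  open CommutativeRing R hiding (trans) renaming (refl to ≈-refl; sym to ≈-sym)
  open SimpleGraph G

  InPathIdeal-0# : ∀ {u w} (P : Walk G u w) → InPathIdeal G R α P 0#
  InPathIdeal-0# []            = lift ≈-refl
  InPathIdeal-0# ((e , _) ∷ P) =
    0# , 0# , Ideal.∋-0# (α e) , InPathIdeal-0# P , ≈-sym (+-identityʳ 0#)

  InPathIdeal-head : ∀ {u v w y} {e} (j : Joins e u v) (P : Walk G v w) →
                     α e ∋ y → InPathIdeal G R α ((e , j) ∷ P) y
  InPathIdeal-head {y = y} _ P y∈αe =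
    y , 0# , y∈αe , InPathIdeal-0# P , ≈-sym (+-identityʳ y)

  InPathIdeal-tail : ∀ {u v w y} {e} (j : Joins e u v) (P : Walk G v w) →
                     InPathIdeal G R α P y → InPathIdeal G R α ((e , j) ∷ P) y
  InPathIdeal-tail {y = y} {e} _ _ y∈αP =
    0# , y , Ideal.∋-0# (α e) , y∈αP , ≈-sym (+-identityˡ y)

  IsSpline-Joins : ∀ {ρ e u v} → IsSpline G R α ρ → Joins e u v → α e ∋ (ρ u - ρ v)
  IsSpline-Joins {ρ} {e} spline (inj₁ e=uv) =
    subst (λ ends → α e ∋ (ρ (proj₁ ends) - ρ (proj₂ ends))) e=uv (spline e)
  IsSpline-Joins {ρ} {e} spline (inj₂ e=vu) =
    ∋-diff-swap (α e) (IsSpline-Joins {ρ} spline (inj₁ e=vu))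

module _ {c ℓ ℓi} {R : CommutativeRing c ℓ} {G G' : SimpleGraph} (S : Subgraph G' G)
         (β : EdgeLabeling G' R ℓi) where
  open Subgraph S
  module G  = SimpleGraph G
  module G' = SimpleGraph G'

  -- Membership is phrased through preimages so that no decision about the
  -- image of emap is needed; an edge outside the image gets the whole ring.
  extend : EdgeLabeling G R ℓi
  extend e = record
    { _∋_      = λ x → ∀ e' → emap e' ≡ e → β e' ∋ x
    ; ∋-resp-≈ = λ x≈y x∈ e' eq → Ideal.∋-resp-≈ (β e') x≈y (x∈ e' eq)
    ; ∋-0#     = λ e' _ → Ideal.∋-0# (β e')
    ; ∋-+      = λ x∈ y∈ e' eq → Ideal.∋-+ (β e') (x∈ e' eq) (y∈ e' eq)
    ; ∋-*      = λ r x∈ e' eq → Ideal.∋-* (β e') r (x∈ e' eq)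
    }

  extend-∋⁺ : ∀ e' {x} → β e' ∋ x → extend (emap e') ∋ x
  extend-∋⁺ e' x∈ _ eq with emap-inj eq
  ... | refl = x∈

  extend-∋⁻ : ∀ e' {x} → extend (emap e') ∋ x → β e' ∋ x
  extend-∋⁻ e' x∈ = x∈ e' refl

  lift-neighbour : ∀ e' a' {v} → G.Joins (emap e') (vmap a') v →
                   Σ[ v' ∈ Fin G'.nV ] (G'.Joins e' a' v' × v ≡ vmap v')
  lift-neighbour e' a' j with Joins-unique G.graph j (ends-compat e')
  ... | inj₁ eq with vmap-inj (,-injectiveˡ eq)
  ...   | refl = proj₂ (G'.ends e') , inj₁ refl , ,-injectiveʳ eq
  lift-neighbour e' a' j | inj₂ eq with vmap-inj (,-injectiveˡ eq)
  ...   | refl = proj₁ (G'.ends e') , inj₂ refl , ,-injectiveʳ eq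

  FullPathIdeal : ∀ {u w} → Walk G u w → Set (c ⊔ ℓ ⊔ ℓi)
  FullPathIdeal Q = ∀ y → InPathIdeal G R extend Q y

  full-or-lift : ∀ {a' w' b} (Q : Walk G (vmap a') b) → b ≡ vmap w' →
    FullPathIdeal Q ⊎
    Σ[ P ∈ Walk G' a' w' ] (map vmap (vertices G' P) ≡ vertices G Q ×
                            (∀ {y} → InPathIdeal G' R β P y → InPathIdeal G R extend Q y))
  full-or-lift [] b=w' with vmap-inj b=w'
  ... | refl = inj₂ ([] , refl , λ y∈ → y∈)
  full-or-lift {a'} ((e , j) ∷ Q) b=w' with any? (λ e' → emap e' ≟ᶠ e)
  ... | no e∉image =
    inj₁ λ y → InPathIdeal-head G extend j Q λ e' eq → contradiction (e' , eq) e∉image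
  ... | yes (e' , refl) with lift-neighbour e' a' j
  ...   | v' , j' , refl with full-or-lift Q b=w'
  ...     | inj₁ full = inj₁ λ y → InPathIdeal-tail G extend j Q (full y)
  ...     | inj₂ (P , vertices-eq , ⊆) =
    inj₂ ((e' , j') ∷ P , cong (vmap a' ∷_) vertices-eq ,
          λ { (a , b , a∈ , b∈ , y≈a+b) → a , b , extend-∋⁺ e' a∈ , ⊆ b∈ , y≈a+b })

  ∈-path-ideals-extend : ∀ {u' w' x} →
    (∀ (P : Walk G' u' w') → IsPath G' P → InPathIdeal G' R β P x) →
    ∀ (Q : Walk G (vmap u') (vmap w')) → IsPath G Q → InPathIdeal G R extend Q x
  ∈-path-ideals-extend {x = x} x∈β Q Q-path with full-or-lift Q refl
  ... | inj₁ full = full x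
  ... | inj₂ (P , vertices-eq , ⊆) =
    ⊆ (x∈β P (map⁻ (subst Unique (sym vertices-eq) Q-path)))

  restrict-spline : ∀ ρ → IsSpline G R extend ρ → IsSpline G' R β (ρ ∘ vmap)
  restrict-spline ρ spline e' =
    extend-∋⁻ e' (IsSpline-Joins G extend {ρ} spline (ends-compat e'))

lemma5p2 : ∀ {c ℓ} (ℓi : Level) (R : CommutativeRing c ℓ) (G G' : SimpleGraph) →
    Subgraph G' G →
    (∀ (α : EdgeLabeling G R ℓi) → UniversalDifferenceProperty G R α) →
    ∀ (β : EdgeLabeling G' R ℓi) → UniversalDifferenceProperty G' R β
lemma5p2 ℓi R G G' S udp β u' w' x x∈β =
  let ρ , spline , ρu-ρw≈x = udp (extend S β) (vmap u') (vmap w') x (∈-path-ideals-extend S β x∈β)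
  in  ρ ∘ vmap , restrict-spline S β ρ spline , ρu-ρw≈x
  where open Subgraph S using (vmap)
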